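{- Let $\mathbb{C}$ be one of the categories $\mathbb{C}_{\mathrm{rn}},\mathbb{C}_{\mathrm{vs}},\mathbb{C}_{\mathrm{ts}}$, let $T$ be a coherent theory and $\Vdash$ the forcing relation on $\mathbb{C}$ with respect to the coverage $\lhd_T$. Then for every generalized geometric implication $\phi$ with free variables in a set $Y$, every condition $(X;A)$ and every environment $\rho:Y\to\mathrm{Tm}(X)$: if $(X;A)\Vdash\phi\rho$, then $T,A\vdash_X\phi\rho$.
   Context: Fix a single-sorted first-order signature $\Sigma$ without equality and a countably infinite set of variables; $\mathrm{Tm}(X)$ is the set of $\Sigma$-terms with variables in $X$. A condition is a pair $(X;A)$, $X$ a finite set of variables, $A$ a finite set of atoms with variables in $X$; $(X,\vec x;A,\psi)$ adds fresh variables $\vec x$ and the atoms of the conjunction $\psi$. Substitutions act postfix, composition in diagram order. $\mathbb{C}_{\mathrm{ts}}$: morphisms $f:(Y;B)\to(X;A)$ are maps $f:X\to\mathrm{Tm}(Y)$ with $Af\subseteq B$; $\mathbb{C}_{\mathrm{vs}}$: those $f$ sending variables to variables; $\mathbb{C}_{\mathrm{rn}}$: those that are moreover injective. A coherent theory $T$ is a set of axioms $\forall\vec x.(\phi_0\to\exists\vec x_1.\phi_1\lor\dots\lor\exists\vec x_k.\phi_k)$ with each $\phi_i$ a finite conjunction of atoms. The relation $C\lhd_T U$ (written also $U\rhd C$) is inductively generated by: (a) $(X;A)\lhd_T\{f\}$ for every isomorphism $f$ with codomain $(X;A)$; (b) if $\phi_0\to\exists\vec x_1.\phi_1\lor\dots\lor\exists\vec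 x_n.\phi_n$ is an instance of an axiom of $T$ (terms of $\mathrm{Tm}(X)$ substituted for the universal variables) with atoms of $\phi_0$ in $A$, $\vec x_i$ fresh, and $(X,\vec x_i;A,\phi_i)\lhd_T U_i$ for all $i$, then $(X;A)\lhd_T\bigcup_ie_iU_i$ with $e_i:(X,\vec x_i;A,\phi_i)\to(X;A)$ the identity on $X$. Forcing: $C\Vdash\top$ always; $C\Vdash\bot$ iff $C\lhd_T\emptyset$; atom $\psi$: iff some $U\rhd C$ has $\psi f\in\mathrm{Fact}(D)$ for all $f:D\to C$ in $U$; $\bigwedge$: componentwise; $C\Vdash\bigvee_i\psi_i$ iff some $U\rhd C$ such that each $f:D\to C$ in $U$ has $D\Vdash\psi_if$ for some $i$; $C\Vdash\psi_1\to\psi_2$ iff for all $f:D\to C$, $D\Vdash\psi_1f$ implies $D\Vdash\psi_2f$; $C\Vdash\forall x.\psi$ iff $D\Vdash\psi[f,x:=t]$ for all $f:D\to C$ and $t\in\mathrm{Tm}(D)$; $C\Vdash\exists x.\psi$ iff some $U\rhd C$ such that each $f:D\to C$ in $U$ has some $t\in\mathrm{Tm}(D)$ with $D\Vdash\psi[f,x:=t]$. Generalized geometric implications are generated by $\phi::=\alpha\mid\phi_1\land\phi_2\mid\bigvee_{i\in I}\phi_i\mid\exists x.\phi\mid\forall x.\phi\mid\alpha\to\phi$ with $I$ small and $\alpha$ an atom, $\top$ or $\bot$ (no equality, as $\Sigma$ has none). $\Gamma\vdash_X\psi$ denotes derivability in intuitionistic natural deduction (with infinitary $\bigvee,\bigwedge$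 rules, infinitary proofs allowed) where all formulas have free variables in the finite set $X$, with quantifier rules suited to possibly empty domains: $\forall$-intro from $\Gamma\vdash_{X,x}\psi$ ($x$ not free in $\Gamma$), $\exists$-intro and $\forall$-elim only with terms $t\in\mathrm{Tm}(X)$, $\exists$-elim via $\Gamma,\psi\vdash_{X,x}\chi$; $T,A\vdash_X\psi$ means $\psi$ is derivable from the axioms of $T$ and the atoms in $A$. -}

module Defs where

open import Level using (Lift; lift)
open import Data.Nat using (ℕ; zero; suc; _+_)
open import Data.Fin using (Fin; zero; suc; _↑ˡ_; _↑ʳ_; splitAt)
open import Data.Fin.Properties using (↑ʳ-injective)
open import Data.Vec using (Vec; []; _∷_)
open import Data.List using (List; []; _∷_; map; _++_)
open import Data.List.Membership.Propositional using (_∈_)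
open import Data.List.Membership.Propositional.Properties using (∈-map⁺; ∈-++⁺ˡ)
open import Data.Product using (Σ; _×_; _,_; proj₁; proj₂)
open import Data.Sum using (_⊎_; inj₁; inj₂; [_,_]′)
open import Data.Unit using (⊤; tt)
open import Relation.Nullary using (¬_)
open import Relation.Binary.PropositionalEquality using (_≡_; refl; cong; cong₂; subst; sym; trans)

-- Single-sorted first-order signature without equality

record Signature : Set₁ where
  field
    Fun    : Set
    funAr  : Fun → ℕ
    Rel    : Set
    relAr  : Rel → ℕ

data Kind : Set where
  Crn Cvs Cts : Kind

module _ (S : Signature) where
  open Signature S

  -- Terms and atoms over a finite set of variables, represented as Fin n
  -- (de Bruijn style; a finite variable set X of size n).

  data Tm (n : ℕ) : Set where
    var : Fin n → Tm n
    app : (f : Fun) → Vec (Tm n) (funAr f) → Tm n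

  record Atom (n : ℕ) : Set where
    constructor mkAtom
    field
      rel  : Rel
      args : Vec (Tm n) (relAr rel)

  mutual
    substTm : {n m : ℕ} → Tm n → (Fin n → Tm m) → Tm m
    substTm (var x) σ = σ x
    substTm (app f ts) σ = app f (substTms ts σ)

    substTms : {n m k : ℕ} → Vec (Tm n) k → (Fin n → Tm m) → Vec (Tm m) k
    substTms [] σ = []
    substTms (t ∷ ts) σ = substTm t σ ∷ substTms ts σ

  substAt : {n m : ℕ} → Atom n → (Fin n → Tm m) → Atom m
  substAt (mkAtom r ts) σ = mkAtom r (substTms ts σ)

  -- composition of substitutions in diagram order: first σ then τ
  _⨾_ : {n m k : ℕ} → (Fin n → Tm m) → (Fin m → Tm k) → Fin n → Tm k
  (σ ⨾ τ) x = substTm (σ x) τ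

  mutual
    fuseTm : {n m k : ℕ} (r : Fin n → Fin m) (g : Fin m → Tm k) (t : Tm n) →
             substTm (substTm t (λ x → var (r x))) g ≡ substTm t (λ x → g (r x))
    fuseTm r g (var x) = refl
    fuseTm r g (app f ts) = cong (app f) (fuseTms r g ts)

    fuseTms : {n m k j : ℕ} (r : Fin n → Fin m) (g : Fin m → Tm k) (ts : Vec (Tm n) j) →
              substTms (substTms ts (λ x → var (r x))) g ≡ substTms ts (λ x → g (r x))
    fuseTms r g [] = refl
    fuseTms r g (t ∷ ts) = cong₂ _∷_ (fuseTm r g t) (fuseTms r g ts)

  fuseAt : {n m k : ℕ} (r : Fin n → Fin m) (g : Fin m → Tm k) (a : Atom n) →
           substAt (substAt a (λ x → var (r x))) g ≡ substAt a (λ x → g (r x))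
  fuseAt r g (mkAtom rl ts) = cong (mkAtom rl) (fuseTms r g ts)

  -- Conditions (X;A): X of size ctx, A a finite set of atoms (as a list,
  -- used only through membership)

  record Cond : Set where
    constructor cond
    field
      ctx   : ℕ
      atoms : List (Atom ctx)
  open Cond public

  IsKind : Kind → {n m : ℕ} → (Fin n → Tm m) → Set
  IsKind Cts f = ⊤
  IsKind Cvs f = ∀ x → Σ _ λ y → f x ≡ var y
  IsKind Crn f = (∀ x → Σ _ λ y → f x ≡ var y) × (∀ x x' → f x ≡ f x' → x ≡ x')

  -- f : (Y;B) → (X;A) is a map X → Tm(Y) with A f ⊆ B
  record Hom (κ : Kind) (D C : Cond) : Set where
    constructor hom
    field
      fn    : Fin (ctx C) → Tm (ctx D)
      kind  : IsKind κ fn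
      incl  : ∀ a → a ∈ atoms C → substAt a fn ∈ atoms D
  open Hom public

  IsIso : (κ : Kind) {D C : Cond} → Hom κ D C → Set
  IsIso κ {D} {C} f = Σ (Hom κ C D) λ g →
    (∀ x → (Hom.fn f ⨾ Hom.fn g) x ≡ var x) × (∀ y → (Hom.fn g ⨾ Hom.fn f) y ≡ var y)

  -- families of morphisms with common codomain (sets U of morphisms)
  record Family (κ : Kind) (C : Cond) : Set₁ where
    field
      Idx : Set
      dom : Idx → Cond
      mor : (i : Idx) → Hom κ (dom i) C
  open Family public

  -- Coherent axioms  ∀ x⃗.(φ0 → ∃ x⃗1.φ1 ∨ … ∨ ∃ x⃗k.φk)
  -- (universal variables Fin nv, the i-th disjunct has ex i further
  --  variables; its atoms live over Fin (ex i + nv))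

  record CohAxiom : Set where
    field
      nv    : ℕ
      prem  : List (Atom nv)
      k     : ℕ
      ex    : Fin k → ℕ
      concl : (i : Fin k) → List (Atom (ex i + nv))
  open CohAxiom public

  Theory : Set₁
  Theory = CohAxiom → Set

  -- weakening by m fresh variables placed in front
  wkBy : (m : ℕ) {n : ℕ} → Fin n → Tm (m + n)
  wkBy m x = var (m ↑ʳ x)

  -- substitution for an instance: new variables ↦ fresh variables,
  -- universal variables ↦ σ (weakened)
  instSubst : {nv n : ℕ} (m : ℕ) → (Fin nv → Tm n) → Fin (m + nv) → Tm (m + n)
  instSubst {nv} {n} m σ x =
    [ (λ j → var (j ↑ˡ n)) , (λ y → substTm (σ y) (wkBy m)) ]′ (splitAt m x)

  extCond : (C : Cond) (ax : CohAxiom) (σ : Fin (nv ax) → Tm (ctx C)) (i : Fin (k ax)) → Cond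
  extCond C ax σ i =
    cond (ex ax i + ctx C)
         (map (λ a → substAt a (wkBy (ex ax i))) (atoms C)
          ++ map (λ a → substAt a (instSubst (ex ax i) σ)) (concl ax i))

  -- g ⨾ e_i  where  e_i : (X, x⃗i; A, φi) → (X;A) is the identity on X
  composeE : (κ : Kind) (C : Cond) (ax : CohAxiom) (σ : Fin (nv ax) → Tm (ctx C))
             (i : Fin (k ax)) {D : Cond} → Hom κ D (extCond C ax σ i) → Hom κ D C
  composeE κ C ax σ i {D} g = hom h (kd κ (kind g)) inc
    where
      m = ex ax i
      h : Fin (ctx C) → Tm (ctx D)
      h x = Hom.fn g (m ↑ʳ x)
      kd : (κ' : Kind) → IsKind κ' (Hom.fn g) → IsKind κ' h
      kd Cts _ = tt
      kd Cvs v = λ x → v (m ↑ʳ x)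
      kd Crn (v , inj) = (λ x → v (m ↑ʳ x)) ,
                        (λ x x' eq → ↑ʳ-injective m x x' (inj _ _ eq))
      inc : ∀ a → a ∈ atoms C → substAt a h ∈ atoms D
      inc a a∈ = subst (_∈ atoms D) (fuseAt (m ↑ʳ_) (Hom.fn g) a)
                   (incl g _ (∈-++⁺ˡ (∈-map⁺ (λ b → substAt b (wkBy m)) a∈)))

  singleton : (κ : Kind) {D C : Cond} → Hom κ D C → Family κ C
  singleton κ {D} f = record { Idx = ⊤ ; dom = λ _ → D ; mor = λ _ → f }

  unionE : (κ : Kind) (C : Cond) (ax : CohAxiom) (σ : Fin (nv ax) → Tm (ctx C)) →
           ((i : Fin (k ax)) → Family κ (extCond C ax σ i)) → Family κ C
  unionE κ C ax σ U = record
    { Idx = Σ (Fin (k ax)) (λ i → Idx (U i))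
    ; dom = λ p → dom (U (proj₁ p)) (proj₂ p)
    ; mor = λ p → composeE κ C ax σ (proj₁ p) (mor (U (proj₁ p)) (proj₂ p))
    }

  data Covers (κ : Kind) (T : Theory) : (C : Cond) → Family κ C → Set₁ where
    cov-iso : {C D : Cond} (f : Hom κ D C) → IsIso κ f → Covers κ T C (singleton κ f)
    cov-ax  : {C : Cond} (ax : CohAxiom) → T ax →
              (σ : Fin (nv ax) → Tm (ctx C)) →
              (∀ a → a ∈ prem ax → substAt a σ ∈ atoms C) →
              (U : (i : Fin (k ax)) → Family κ (extCond C ax σ i)) →
              ((i : Fin (k ax)) → Covers κ T (extCond C ax σ i) (U i)) →
              Covers κ T C (unionE κ C ax σ U)

  -- Formulas (infinitary, small index sets), free variables in Fin n;
  -- ∀'/∃' bind variable zero.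

  data Fm (n : ℕ) : Set₁ where
    ⊤'   : Fm n
    ⊥'   : Fm n
    atom : Atom n → Fm n
    _∧'_ : Fm n → Fm n → Fm n
    _⇒_  : Fm n → Fm n → Fm n
    ⋀    : {I : Set} → (I → Fm n) → Fm n
    ⋁    : {I : Set} → (I → Fm n) → Fm n
    ∀'   : Fm (suc n) → Fm n
    ∃'   : Fm (suc n) → Fm n

  _∷ₛ_ : {n m : ℕ} → Tm m → (Fin n → Tm m) → Fin (suc n) → Tm m
  (t ∷ₛ ρ) zero = t
  (t ∷ₛ ρ) (suc x) = ρ x

  liftS : {n m : ℕ} → (Fin n → Tm m) → Fin (suc n) → Tm (suc m)
  liftS σ = var zero ∷ₛ (λ x → substTm (σ x) (λ y → var (suc y)))

  substFm : {n m : ℕ} → Fm n → (Fin n → Tm m) → Fm m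
  substFm ⊤' σ = ⊤'
  substFm ⊥' σ = ⊥'
  substFm (atom a) σ = atom (substAt a σ)
  substFm (φ ∧' ψ) σ = substFm φ σ ∧' substFm ψ σ
  substFm (φ ⇒ ψ) σ = substFm φ σ ⇒ substFm ψ σ
  substFm (⋀ φ) σ = ⋀ (λ i → substFm (φ i) σ)
  substFm (⋁ φ) σ = ⋁ (λ i → substFm (φ i) σ)
  substFm (∀' φ) σ = ∀' (substFm φ (liftS σ))
  substFm (∃' φ) σ = ∃' (substFm φ (liftS σ))

  weakenFm : {n : ℕ} → Fm n → Fm (suc n)
  weakenFm φ = substFm φ (λ x → var (suc x))

  inst : {n : ℕ} → Fm (suc n) → Tm n → Fm n
  inst φ t = substFm φ (t ∷ₛ var)

  data Prim {n : ℕ} : Fm n → Set₁ where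
    p-atom : (a : Atom n) → Prim (atom a)
    p-⊤    : Prim ⊤'
    p-⊥    : Prim ⊥'

  data GGI {n : ℕ} : Fm n → Set₁ where
    g-prim : {α : Fm n} → Prim α → GGI α
    g-∧    : {φ ψ : Fm n} → GGI φ → GGI ψ → GGI (φ ∧' ψ)
    g-⋁    : {I : Set} {φ : I → Fm n} → (∀ i → GGI (φ i)) → GGI (⋁ φ)
    g-∃    : {φ : Fm (suc n)} → GGI φ → GGI (∃' φ)
    g-∀    : {φ : Fm (suc n)} → GGI φ → GGI (∀' φ)
    g-⇒    : {α φ : Fm n} → Prim α → GGI φ → GGI (α ⇒ φ)

  -- Forcing.  ForcesEnv κ T C ψ ρ  means  C ⊩ ψρ  (ρ : free vars → Tm(C));
  -- the environment form makes the recursion structural.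

  ForcesEnv : (κ : Kind) (T : Theory) (C : Cond) {m : ℕ} → Fm m → (Fin m → Tm (ctx C)) → Set₁
  ForcesEnv κ T C ⊤' ρ = Lift _ ⊤
  ForcesEnv κ T C ⊥' ρ = Σ (Family κ C) λ U → Covers κ T C U × ¬ Idx U
  ForcesEnv κ T C (atom a) ρ = Σ (Family κ C) λ U → Covers κ T C U ×
    (∀ j → substAt (substAt a ρ) (Hom.fn (mor U j)) ∈ atoms (dom U j))
  ForcesEnv κ T C (φ ∧' ψ) ρ = ForcesEnv κ T C φ ρ × ForcesEnv κ T C ψ ρ
  ForcesEnv κ T C (φ ⇒ ψ) ρ = ∀ (D : Cond) (f : Hom κ D C) →
    ForcesEnv κ T D φ (ρ ⨾ Hom.fn f) → ForcesEnv κ T D ψ (ρ ⨾ Hom.fn f)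
  ForcesEnv κ T C (⋀ φ) ρ = ∀ i → ForcesEnv κ T C (φ i) ρ
  ForcesEnv κ T C (⋁ φ) ρ = Σ (Family κ C) λ U → Covers κ T C U ×
    (∀ j → Σ _ λ i → ForcesEnv κ T (dom U j) (φ i) (ρ ⨾ Hom.fn (mor U j)))
  ForcesEnv κ T C (∀' φ) ρ = ∀ (D : Cond) (f : Hom κ D C) (t : Tm (ctx D)) →
    ForcesEnv κ T D φ (t ∷ₛ (ρ ⨾ Hom.fn f))
  ForcesEnv κ T C (∃' φ) ρ = Σ (Family κ C) λ U → Covers κ T C U ×
    (∀ j → Σ (Tm (ctx (dom U j))) λ t →
       ForcesEnv κ T (dom U j) φ (t ∷ₛ (ρ ⨾ Hom.fn (mor U j))))

  Forces : (κ : Kind) (T : Theory) (C : Cond) → Fm (ctx C) → Set₁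
  Forces κ T C ψ = ForcesEnv κ T C ψ var

  -- Intuitionistic natural deduction (infinitary), hypotheses a set Γ of
  -- formulas with free variables in Fin n; possibly empty domains.

  Ctx : ℕ → Set₂
  Ctx n = Fm n → Set₁

  _,,_ : {n : ℕ} → Ctx n → Fm n → Ctx n
  (Γ ,, φ) χ = Γ χ ⊎ (χ ≡ φ)

  wkCtx : {n : ℕ} → Ctx n → Ctx (suc n)
  wkCtx Γ χ = Σ (Fm _) λ ψ → Γ ψ × (χ ≡ weakenFm ψ)

  data _⊢_ : {n : ℕ} → Ctx n → Fm n → Set₂ where
    hyp  : ∀ {n} {Γ : Ctx n} {φ} → Γ φ → Γ ⊢ φ
    ⊤I   : ∀ {n} {Γ : Ctx n} → Γ ⊢ ⊤'
    ⊥E   : ∀ {n} {Γ : Ctx n} {φ} → Γ ⊢ ⊥' → Γ ⊢ φ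
    ∧I   : ∀ {n} {Γ : Ctx n} {φ ψ} → Γ ⊢ φ → Γ ⊢ ψ → Γ ⊢ (φ ∧' ψ)
    ∧E₁  : ∀ {n} {Γ : Ctx n} {φ ψ} → Γ ⊢ (φ ∧' ψ) → Γ ⊢ φ
    ∧E₂  : ∀ {n} {Γ : Ctx n} {φ ψ} → Γ ⊢ (φ ∧' ψ) → Γ ⊢ ψ
    ⇒I   : ∀ {n} {Γ : Ctx n} {φ ψ} → (Γ ,, φ) ⊢ ψ → Γ ⊢ (φ ⇒ ψ)
    ⇒E   : ∀ {n} {Γ : Ctx n} {φ ψ} → Γ ⊢ (φ ⇒ ψ) → Γ ⊢ φ → Γ ⊢ ψ
    ⋀I   : ∀ {n} {Γ : Ctx n} {I : Set} {φ : I → Fm n} → (∀ i → Γ ⊢ φ i) → Γ ⊢ ⋀ φ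
    ⋀E   : ∀ {n} {Γ : Ctx n} {I : Set} {φ : I → Fm n} → Γ ⊢ ⋀ φ → (i : I) → Γ ⊢ φ i
    ⋁I   : ∀ {n} {Γ : Ctx n} {I : Set} {φ : I → Fm n} (i : I) → Γ ⊢ φ i → Γ ⊢ ⋁ φ
    ⋁E   : ∀ {n} {Γ : Ctx n} {I : Set} {φ : I → Fm n} {χ} →
           Γ ⊢ ⋁ φ → (∀ i → (Γ ,, φ i) ⊢ χ) → Γ ⊢ χ
    ∀I   : ∀ {n} {Γ : Ctx n} {φ} → wkCtx Γ ⊢ φ → Γ ⊢ ∀' φ
    ∀E   : ∀ {n} {Γ : Ctx n} {φ} → Γ ⊢ ∀' φ → (t : Tm n) → Γ ⊢ inst φ t
    ∃I   : ∀ {n} {Γ : Ctx n} {φ} (t : Tm n) → Γ ⊢ inst φ t → Γ ⊢ ∃' φ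
    ∃E   : ∀ {n} {Γ : Ctx n} {φ χ} → Γ ⊢ ∃' φ →
           (wkCtx Γ ,, φ) ⊢ weakenFm χ → Γ ⊢ χ

  conj : {n : ℕ} → List (Atom n) → Fm n
  conj [] = ⊤'
  conj (a ∷ as) = atom a ∧' conj as

  ∀* : (k : ℕ) → Fm k → Fm 0
  ∀* zero φ = φ
  ∀* (suc k) φ = ∀* k (∀' φ)

  ∃* : (m : ℕ) {n : ℕ} → Fm (m + n) → Fm n
  ∃* zero φ = φ
  ∃* (suc m) φ = ∃* m (∃' φ)

  axiomFm : CohAxiom → Fm 0
  axiomFm ax = ∀* (nv ax)
    (conj (prem ax) ⇒ ⋁ (λ (i : Fin (k ax)) → ∃* (ex ax i) (conj (concl ax i))))

  noVars : {n : ℕ} → Fin 0 → Tm n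
  noVars ()

  TA : {n : ℕ} → Theory → List (Atom n) → Ctx n
  TA T A χ = (Σ CohAxiom λ ax → T ax × (χ ≡ substFm (axiomFm ax) noVars))
           ⊎ (Σ (Atom _) λ a → a ∈ A × (χ ≡ atom a))

  Derivable : (T : Theory) {n : ℕ} → List (Atom n) → Fm n → Set₂
  Derivable T A ψ = TA T A ⊢ ψ

-- The proof is an induction on the generalized geometric implication φ,
-- for an arbitrary environment ρ (forced-derivable); the theorem is its
-- instance ρ = var, applied to φρ, which is again such an implication.
-- The only non-syntactic ingredient is that derivability is LOCAL for the
-- coverage ◁_T: if C ◁ U and every member D → C of U derives ψ, then C
-- derives ψ.  An isomorphism cover is handled by substituting along the
-- inverse morphism inside a derivation; an axiom cover by instantiating the
-- coherent axiom, splitting its disjunction and opening its existentials.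
--
-- Since formulas are infinitary (⋀, ⋁ over arbitrary index sets) the
-- equation φ⟨σ⟩⟨τ⟩ ≡ φ⟨σ ⨾ τ⟩ is not provable without function
-- extensionality.  We therefore work with the relation φ ≃ ψ ("φ and ψ are
-- the same formula under two chains of substitutions with pointwise equal
-- composites") and show that derivability is invariant under it.

module Submission where

open import Defs hiding (_⨾_; _∷ₛ_; _,,_; _⊢_)
import Defs as D
open import Level using (lift)
open import Data.Nat using (ℕ; zero; suc; _+_)
open import Data.Fin using (Fin; zero; suc; _↑ˡ_; splitAt)
open import Data.Vec using (Vec; []; _∷_)
open import Data.List using (List; []; _∷_; map; _++_)
open import Data.List.Membership.Propositional using (_∈_)
open import Data.List.Relation.Unary.Any using (here; there)
open import Data.List.Membership.Propositional.Properties using (∈-map⁺; ∈-map⁻; ∈-++⁻)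
open import Data.Product using (Σ; _×_; _,_)
open import Data.Sum using (_⊎_; inj₁; inj₂; [_,_]′; map₁)
open import Data.Unit using (tt)
open import Data.Empty using (⊥-elim)
open import Relation.Binary.PropositionalEquality using (_≡_; refl; cong; cong₂; subst; sym; trans)

module _ (S : Signature) where

  private variable
    n m l p : ℕ

  Subst : ℕ → ℕ → Set
  Subst n m = Fin n → Tm S m

  infixl 25 _⟨_⟩ᵗ _⟨_⟩ᵛ _⟨_⟩ᵃ _⟨_⟩ _⟨_⟩*
  infixl 7 _⨾_
  infixr 6 _∷ₛ_
  infix  4 _≈_ _≃_ _⊆_ _⊆[_]_
  infixl 5 _,,_
  infix  2 _⊢_ _⊢ᶜ_
  infixr 1 _⟫_

  _⟨_⟩ᵗ : Tm S n → Subst n m → Tm S m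
  t ⟨ σ ⟩ᵗ = substTm S t σ

  _⟨_⟩ᵛ : Vec (Tm S n) l → Subst n m → Vec (Tm S m) l
  ts ⟨ σ ⟩ᵛ = substTms S ts σ

  _⟨_⟩ᵃ : Atom S n → Subst n m → Atom S m
  a ⟨ σ ⟩ᵃ = substAt S a σ

  _⟨_⟩ : Fm S n → Subst n m → Fm S m
  φ ⟨ σ ⟩ = substFm S φ σ

  _⨾_ : Subst n m → Subst m l → Subst n l
  σ ⨾ τ = D._⨾_ S σ τ

  _∷ₛ_ : Tm S m → Subst n m → Subst (suc n) m
  t ∷ₛ σ = D._∷ₛ_ S t σ

  _,,_ : Ctx S n → Fm S n → Ctx S n
  Γ ,, φ = D._,,_ S Γ φ

  _⊢_ : Ctx S n → Fm S n → Set₂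
  Γ ⊢ φ = D._⊢_ S Γ φ

  wk : Subst n (suc n)
  wk x = var (suc x)

  _≈_ : Subst n m → Subst n m → Set
  σ ≈ σ' = ∀ x → σ x ≡ σ' x

  -- Term substitution is associative and unital.  The associativity law is
  -- stated for any σ' agreeing with σ ⨾ τ, which is how it is always used.

  mutual
    ⟨⟩ᵗ-fuse : {σ : Subst n m} {τ : Subst m l} {σ' : Subst n l} (t : Tm S n) →
               (∀ x → σ x ⟨ τ ⟩ᵗ ≡ σ' x) → t ⟨ σ ⟩ᵗ ⟨ τ ⟩ᵗ ≡ t ⟨ σ' ⟩ᵗ
    ⟨⟩ᵗ-fuse (var x) e = e x
    ⟨⟩ᵗ-fuse (app f ts) e = cong (app f) (⟨⟩ᵛ-fuse ts e)

    ⟨⟩ᵛ-fuse : {σ : Subst n m} {τ : Subst m l} {σ' : Subst n l} (ts : Vec (Tm S n) p) →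
               (∀ x → σ x ⟨ τ ⟩ᵗ ≡ σ' x) → ts ⟨ σ ⟩ᵛ ⟨ τ ⟩ᵛ ≡ ts ⟨ σ' ⟩ᵛ
    ⟨⟩ᵛ-fuse [] e = refl
    ⟨⟩ᵛ-fuse (t ∷ ts) e = cong₂ _∷_ (⟨⟩ᵗ-fuse t e) (⟨⟩ᵛ-fuse ts e)

  mutual
    ⟨⟩ᵗ-id : (t : Tm S n) → t ⟨ var ⟩ᵗ ≡ t
    ⟨⟩ᵗ-id (var x) = refl
    ⟨⟩ᵗ-id (app f ts) = cong (app f) (⟨⟩ᵛ-id ts)

    ⟨⟩ᵛ-id : (ts : Vec (Tm S n) p) → ts ⟨ var ⟩ᵛ ≡ ts
    ⟨⟩ᵛ-id [] = refl
    ⟨⟩ᵛ-id (t ∷ ts) = cong₂ _∷_ (⟨⟩ᵗ-id t) (⟨⟩ᵛ-id ts)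

  ⟨⟩ᵗ-inverse : {σ : Subst n m} {τ : Subst m n} (t : Tm S n) →
                (∀ x → σ x ⟨ τ ⟩ᵗ ≡ var x) → t ⟨ σ ⟩ᵗ ⟨ τ ⟩ᵗ ≡ t
  ⟨⟩ᵗ-inverse t e = trans (⟨⟩ᵗ-fuse t e) (⟨⟩ᵗ-id t)

  ⟨⟩ᵃ-fuse : {σ : Subst n m} {τ : Subst m l} {σ' : Subst n l} (a : Atom S n) →
             (∀ x → σ x ⟨ τ ⟩ᵗ ≡ σ' x) → a ⟨ σ ⟩ᵃ ⟨ τ ⟩ᵃ ≡ a ⟨ σ' ⟩ᵃ
  ⟨⟩ᵃ-fuse (mkAtom r ts) e = cong (mkAtom r) (⟨⟩ᵛ-fuse ts e)

  ⟨⟩ᵃ-id : (a : Atom S n) → a ⟨ var ⟩ᵃ ≡ a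
  ⟨⟩ᵃ-id (mkAtom r ts) = cong (mkAtom r) (⟨⟩ᵛ-id ts)

  ⟨⟩ᵃ-cong : {σ σ' : Subst n m} (a : Atom S n) → σ ≈ σ' → a ⟨ σ ⟩ᵃ ≡ a ⟨ σ' ⟩ᵃ
  ⟨⟩ᵃ-cong a e = trans (cong (_⟨ _ ⟩ᵃ) (sym (⟨⟩ᵃ-id a))) (⟨⟩ᵃ-fuse a e)

  liftS-cong : {σ σ' : Subst n m} → σ ≈ σ' → liftS S σ ≈ liftS S σ'
  liftS-cong e zero = refl
  liftS-cong e (suc x) = cong (_⟨ wk ⟩ᵗ) (e x)

  liftS-⨾ : (σ : Subst n m) (τ : Subst m l) → liftS S σ ⨾ liftS S τ ≈ liftS S (σ ⨾ τ)
  liftS-⨾ σ τ zero = refl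
  liftS-⨾ σ τ (suc x) =
    trans (⟨⟩ᵗ-fuse (σ x) (λ _ → refl)) (sym (⟨⟩ᵗ-fuse (σ x) (λ _ → refl)))

  liftS-inst : (σ : Subst n m) (t : Tm S m) → liftS S σ ⨾ (t ∷ₛ var) ≈ t ∷ₛ σ
  liftS-inst σ t zero = refl
  liftS-inst σ t (suc x) = ⟨⟩ᵗ-inverse (σ x) (λ _ → refl)

  ∷ₛ-η : (τ : Subst (suc n) m) → τ zero ∷ₛ (λ x → τ (suc x)) ≈ τ
  ∷ₛ-η τ zero = refl
  ∷ₛ-η τ (suc x) = refl

  inst-⨾ : (t : Tm S n) (σ : Subst n m) → (t ∷ₛ var) ⨾ σ ≈ t ⟨ σ ⟩ᵗ ∷ₛ σ
  inst-⨾ t σ zero = refl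
  inst-⨾ t σ (suc x) = refl

  -- Chains let the
  -- invariance of derivability under reassociation be proved by induction
  -- on a single formula, through any number of binders.

  data Chain : ℕ → ℕ → Set where
    ε   : Chain n n
    _▷_ : Chain n m → Subst m l → Chain n l

  infixl 5 _▷_

  _⟨_⟩* : Fm S n → Chain n m → Fm S m
  φ ⟨ ε ⟩* = φ
  φ ⟨ c ▷ σ ⟩* = φ ⟨ c ⟩* ⟨ σ ⟩

  composite : Chain n m → Subst n m
  composite ε = var
  composite (c ▷ σ) = composite c ⨾ σ

  liftCh : Chain n m → Chain (suc n) (suc m)
  liftCh ε = ε
  liftCh (c ▷ σ) = liftCh c ▷ liftS S σ

  -- weaken by a fresh variable 0 and instantiate it by the old variable 0:
  -- the effect on a bound formula of eliminating its weakened quantifier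
  -- at variable 0, as done under ∀I and ∃E
  reopen : Chain n (suc m) → Chain n (suc m)
  reopen c = c ▷ liftS S wk ▷ (var zero ∷ₛ var)

  composite-reopen : (c : Chain n (suc m)) → composite (reopen c) ≈ composite c
  composite-reopen c x = trans (⟨⟩ᵗ-fuse (composite c x) (λ y → trans (liftS-inst wk (var zero) y) (∷ₛ-η var y)))
                               (⟨⟩ᵗ-id (composite c x))

  composite-lift : (c : Chain n m) → composite (liftCh c) ≈ liftS S (composite c)
  composite-lift ε zero = refl
  composite-lift ε (suc x) = refl
  composite-lift (c ▷ σ) x =
    trans (cong (_⟨ liftS S σ ⟩ᵗ) (composite-lift c x)) (liftS-⨾ (composite c) σ x)

  lift-agree : (c₁ c₂ : Chain n m) → composite c₁ ≈ composite c₂ →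
               composite (liftCh c₁) ≈ composite (liftCh c₂)
  lift-agree c₁ c₂ e x =
    trans (composite-lift c₁ x) (trans (liftS-cong e x) (sym (composite-lift c₂ x)))

  ⟨⟩*-⊤ : (c : Chain n m) → ⊤' ⟨ c ⟩* ≡ ⊤'
  ⟨⟩*-⊤ ε = refl
  ⟨⟩*-⊤ (c ▷ σ) rewrite ⟨⟩*-⊤ c = refl

  ⟨⟩*-⊥ : (c : Chain n m) → ⊥' ⟨ c ⟩* ≡ ⊥'
  ⟨⟩*-⊥ ε = refl
  ⟨⟩*-⊥ (c ▷ σ) rewrite ⟨⟩*-⊥ c = refl

  ⟨⟩*-atom : (a : Atom S n) (c : Chain n m) → atom a ⟨ c ⟩* ≡ atom (a ⟨ composite c ⟩ᵃ)
  ⟨⟩*-atom a ε = cong atom (sym (⟨⟩ᵃ-id a))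
  ⟨⟩*-atom a (c ▷ σ) rewrite ⟨⟩*-atom a c = cong atom (⟨⟩ᵃ-fuse a (λ _ → refl))

  ⟨⟩*-∧ : (φ ψ : Fm S n) (c : Chain n m) → (φ ∧' ψ) ⟨ c ⟩* ≡ φ ⟨ c ⟩* ∧' ψ ⟨ c ⟩*
  ⟨⟩*-∧ φ ψ ε = refl
  ⟨⟩*-∧ φ ψ (c ▷ σ) rewrite ⟨⟩*-∧ φ ψ c = refl

  ⟨⟩*-⇒ : (φ ψ : Fm S n) (c : Chain n m) → (φ ⇒ ψ) ⟨ c ⟩* ≡ (φ ⟨ c ⟩* ⇒ ψ ⟨ c ⟩*)
  ⟨⟩*-⇒ φ ψ ε = refl
  ⟨⟩*-⇒ φ ψ (c ▷ σ) rewrite ⟨⟩*-⇒ φ ψ c = refl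

  ⟨⟩*-⋀ : {I : Set} (φ : I → Fm S n) (c : Chain n m) → ⋀ φ ⟨ c ⟩* ≡ ⋀ (λ i → φ i ⟨ c ⟩*)
  ⟨⟩*-⋀ φ ε = refl
  ⟨⟩*-⋀ φ (c ▷ σ) rewrite ⟨⟩*-⋀ φ c = refl

  ⟨⟩*-⋁ : {I : Set} (φ : I → Fm S n) (c : Chain n m) → ⋁ φ ⟨ c ⟩* ≡ ⋁ (λ i → φ i ⟨ c ⟩*)
  ⟨⟩*-⋁ φ ε = refl
  ⟨⟩*-⋁ φ (c ▷ σ) rewrite ⟨⟩*-⋁ φ c = refl

  ⟨⟩*-∀ : (φ : Fm S (suc n)) (c : Chain n m) → ∀' φ ⟨ c ⟩* ≡ ∀' (φ ⟨ liftCh c ⟩*)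
  ⟨⟩*-∀ φ ε = refl
  ⟨⟩*-∀ φ (c ▷ σ) rewrite ⟨⟩*-∀ φ c = refl

  ⟨⟩*-∃ : (φ : Fm S (suc n)) (c : Chain n m) → ∃' φ ⟨ c ⟩* ≡ ∃' (φ ⟨ liftCh c ⟩*)
  ⟨⟩*-∃ φ ε = refl
  ⟨⟩*-∃ φ (c ▷ σ) rewrite ⟨⟩*-∃ φ c = refl

  transport-⇒ : {Γ : Ctx S m} (β : Fm S n) (c₁ c₂ : Chain n m) →
                composite c₁ ≈ composite c₂ → Γ ⊢ β ⟨ c₁ ⟩* ⇒ β ⟨ c₂ ⟩*
  transport-⇒ ⊤' c₁ c₂ e rewrite ⟨⟩*-⊤ c₁ | ⟨⟩*-⊤ c₂ = ⇒I ⊤I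
  transport-⇒ ⊥' c₁ c₂ e rewrite ⟨⟩*-⊥ c₁ | ⟨⟩*-⊥ c₂ = ⇒I (⊥E (hyp (inj₂ refl)))
  transport-⇒ (atom a) c₁ c₂ e rewrite ⟨⟩*-atom a c₁ | ⟨⟩*-atom a c₂ =
    ⇒I (hyp (inj₂ (cong atom (⟨⟩ᵃ-cong a (λ x → sym (e x))))))
  transport-⇒ (φ ∧' ψ) c₁ c₂ e rewrite ⟨⟩*-∧ φ ψ c₁ | ⟨⟩*-∧ φ ψ c₂ =
    ⇒I (∧I (⇒E (transport-⇒ φ c₁ c₂ e) (∧E₁ (hyp (inj₂ refl))))
           (⇒E (transport-⇒ ψ c₁ c₂ e) (∧E₂ (hyp (inj₂ refl)))))
  transport-⇒ (φ ⇒ ψ) c₁ c₂ e rewrite ⟨⟩*-⇒ φ ψ c₁ | ⟨⟩*-⇒ φ ψ c₂ =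
    ⇒I (⇒I (⇒E (transport-⇒ ψ c₁ c₂ e)
               (⇒E (hyp (inj₁ (inj₂ refl)))
                   (⇒E (transport-⇒ φ c₂ c₁ (λ x → sym (e x))) (hyp (inj₂ refl))))))
  transport-⇒ (⋀ φ) c₁ c₂ e rewrite ⟨⟩*-⋀ φ c₁ | ⟨⟩*-⋀ φ c₂ =
    ⇒I (⋀I (λ i → ⇒E (transport-⇒ (φ i) c₁ c₂ e) (⋀E (hyp (inj₂ refl)) i)))
  transport-⇒ (⋁ φ) c₁ c₂ e rewrite ⟨⟩*-⋁ φ c₁ | ⟨⟩*-⋁ φ c₂ =
    ⇒I (⋁E (hyp (inj₂ refl)) (λ i → ⋁I i (⇒E (transport-⇒ (φ i) c₁ c₂ e) (hyp (inj₂ refl)))))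
  transport-⇒ (∀' φ) c₁ c₂ e rewrite ⟨⟩*-∀ φ c₁ | ⟨⟩*-∀ φ c₂ =
    ⇒I (∀I (⇒E (transport-⇒ φ (reopen (liftCh c₁)) (liftCh c₂) agree)
               (∀E {φ = φ ⟨ liftCh c₁ ⟩* ⟨ liftS S wk ⟩} (hyp (_ , inj₂ refl , refl)) (var zero))))
    where
      agree : composite (reopen (liftCh c₁)) ≈ composite (liftCh c₂)
      agree x = trans (composite-reopen (liftCh c₁) x) (lift-agree c₁ c₂ e x)
  transport-⇒ (∃' φ) c₁ c₂ e rewrite ⟨⟩*-∃ φ c₁ | ⟨⟩*-∃ φ c₂ =
    ⇒I (∃E (hyp (inj₂ refl))
           (∃I (var zero) (⇒E (transport-⇒ φ (liftCh c₁) (reopen (liftCh c₂)) agree) (hyp (inj₂ refl)))))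
    where
      agree : composite (liftCh c₁) ≈ composite (reopen (liftCh c₂))
      agree x = trans (lift-agree c₁ c₂ e x) (sym (composite-reopen (liftCh c₂) x))

  data _≃_ {m : ℕ} : Fm S m → Fm S m → Set₁ where
    same : {n : ℕ} (β : Fm S n) (c₁ c₂ : Chain n m) →
           composite c₁ ≈ composite c₂ → β ⟨ c₁ ⟩* ≃ β ⟨ c₂ ⟩*
    _⟫_  : {φ ψ χ : Fm S m} → φ ≃ ψ → ψ ≃ χ → φ ≃ χ

  transport : {Γ : Ctx S m} {φ ψ : Fm S m} → φ ≃ ψ → Γ ⊢ φ → Γ ⊢ ψ
  transport (same β c₁ c₂ e) d = ⇒E (transport-⇒ β c₁ c₂ e) d
  transport (r ⟫ r') d = transport r' (transport r d)

  ≃-refl : {φ : Fm S m} → φ ≃ φ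
  ≃-refl {φ = φ} = same φ ε ε (λ _ → refl)

  ≃-sym : {φ ψ : Fm S m} → φ ≃ ψ → ψ ≃ φ
  ≃-sym (same β c₁ c₂ e) = same β c₂ c₁ (λ x → sym (e x))
  ≃-sym (r ⟫ r') = ≃-sym r' ⟫ ≃-sym r

  ≃-⟨⟩ : {φ ψ : Fm S m} (σ : Subst m l) → φ ≃ ψ → φ ⟨ σ ⟩ ≃ ψ ⟨ σ ⟩
  ≃-⟨⟩ σ (same β c₁ c₂ e) = same β (c₁ ▷ σ) (c₂ ▷ σ) (λ x → cong (_⟨ σ ⟩ᵗ) (e x))
  ≃-⟨⟩ σ (r ⟫ r') = ≃-⟨⟩ σ r ⟫ ≃-⟨⟩ σ r'

  ≃-cong : (φ : Fm S n) {σ σ' : Subst n m} → σ ≈ σ' → φ ⟨ σ ⟩ ≃ φ ⟨ σ' ⟩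
  ≃-cong φ {σ} {σ'} e = same φ (ε ▷ σ) (ε ▷ σ') e

  ≃-fuse : (φ : Fm S n) {σ : Subst n m} {τ : Subst m l} {σ' : Subst n l} →
           (∀ x → σ x ⟨ τ ⟩ᵗ ≡ σ' x) → φ ⟨ σ ⟩ ⟨ τ ⟩ ≃ φ ⟨ σ' ⟩
  ≃-fuse φ {σ} {τ} {σ'} e = same φ (ε ▷ σ ▷ τ) (ε ▷ σ') e

  ≃-id : {φ : Fm S n} → φ ⟨ var ⟩ ≃ φ
  ≃-id {φ = φ} = same φ (ε ▷ var) ε (λ _ → refl)

  ≃-closed : (φ : Fm S 0) (τ : Subst n m) → φ ⟨ noVars S ⟩ ⟨ τ ⟩ ≃ φ ⟨ noVars S ⟩
  ≃-closed φ τ = ≃-fuse φ (λ ())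

  _⊆_ : Ctx S n → Ctx S n → Set₁
  Γ ⊆ Δ = ∀ ψ → Γ ψ → Δ ψ

  _⊢ᶜ_ : Ctx S n → Ctx S n → Set₂
  Δ ⊢ᶜ Γ = ∀ ψ → Γ ψ → Δ ⊢ ψ

  ,,-mono : {Γ Δ : Ctx S n} {φ : Fm S n} → Γ ⊆ Δ → Γ ,, φ ⊆ Δ ,, φ
  ,,-mono h ψ (inj₁ g) = inj₁ (h ψ g)
  ,,-mono h ψ (inj₂ e) = inj₂ e

  wkCtx-mono : {Γ Δ : Ctx S n} → Γ ⊆ Δ → wkCtx S Γ ⊆ wkCtx S Δ
  wkCtx-mono h _ (ψ , g , e) = ψ , h ψ g , e

  mono : {Γ Δ : Ctx S n} {φ : Fm S n} → Γ ⊆ Δ → Γ ⊢ φ → Δ ⊢ φ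
  mono h (hyp g) = hyp (h _ g)
  mono h ⊤I = ⊤I
  mono h (⊥E d) = ⊥E (mono h d)
  mono h (∧I d d') = ∧I (mono h d) (mono h d')
  mono h (∧E₁ d) = ∧E₁ (mono h d)
  mono h (∧E₂ d) = ∧E₂ (mono h d)
  mono h (⇒I d) = ⇒I (mono (,,-mono h) d)
  mono h (⇒E d d') = ⇒E (mono h d) (mono h d')
  mono h (⋀I ds) = ⋀I (λ i → mono h (ds i))
  mono h (⋀E d i) = ⋀E (mono h d) i
  mono h (⋁I i d) = ⋁I i (mono h d)
  mono h (⋁E d ds) = ⋁E (mono h d) (λ i → mono (,,-mono h) (ds i))
  mono h (∀I d) = ∀I (mono (wkCtx-mono h) d)
  mono h (∀E d t) = ∀E (mono h d) t
  mono h (∃I t d) = ∃I t (mono h d)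
  mono h (∃E d d') = ∃E (mono h d) (mono (,,-mono (wkCtx-mono h)) d')

  _⊆[_]_ : Ctx S n → Subst n m → Ctx S m → Set₁
  Γ ⊆[ σ ] Δ = ∀ ψ → Γ ψ → Σ (Fm S _) λ θ → Δ θ × θ ≃ ψ ⟨ σ ⟩

  ⊆[]-,, : {Γ : Ctx S n} {Δ : Ctx S m} {σ : Subst n m} (φ : Fm S n) →
           Γ ⊆[ σ ] Δ → Γ ,, φ ⊆[ σ ] Δ ,, φ ⟨ σ ⟩
  ⊆[]-,, φ G ψ (inj₁ g) with G ψ g
  ... | θ , h , r = θ , inj₁ h , r
  ⊆[]-,, φ G _ (inj₂ refl) = _ , inj₂ refl , ≃-refl

  ⊆[]-wk : {Γ : Ctx S n} {Δ : Ctx S m} {σ : Subst n m} →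
           Γ ⊆[ σ ] Δ → wkCtx S Γ ⊆[ liftS S σ ] wkCtx S Δ
  ⊆[]-wk {σ = σ} G _ (ψ , g , refl) with G ψ g
  ... | θ , h , r = θ ⟨ wk ⟩ , (θ , h , refl) ,
                    (≃-⟨⟩ wk r ⟫ same ψ (ε ▷ σ ▷ wk) (ε ▷ wk ▷ liftS S σ) (λ _ → refl))

  substitute : {Γ : Ctx S n} {Δ : Ctx S m} {φ : Fm S n} →
               Γ ⊢ φ → (σ : Subst n m) → Γ ⊆[ σ ] Δ → Δ ⊢ φ ⟨ σ ⟩
  substitute (hyp g) σ G with G _ g
  ... | θ , h , r = transport r (hyp h)
  substitute ⊤I σ G = ⊤I
  substitute (⊥E d) σ G = ⊥E (substitute d σ G)
  substitute (∧I d d') σ G = ∧I (substitute d σ G) (substitute d' σ G)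
  substitute (∧E₁ d) σ G = ∧E₁ (substitute d σ G)
  substitute (∧E₂ d) σ G = ∧E₂ (substitute d σ G)
  substitute (⇒I {φ = φ} d) σ G = ⇒I (substitute d σ (⊆[]-,, φ G))
  substitute (⇒E d d') σ G = ⇒E (substitute d σ G) (substitute d' σ G)
  substitute (⋀I ds) σ G = ⋀I (λ i → substitute (ds i) σ G)
  substitute (⋀E d i) σ G = ⋀E (substitute d σ G) i
  substitute (⋁I i d) σ G = ⋁I i (substitute d σ G)
  substitute (⋁E {φ = φ} d ds) σ G = ⋁E (substitute d σ G) (λ i → substitute (ds i) σ (⊆[]-,, (φ i) G))
  substitute (∀I d) σ G = ∀I (substitute d (liftS S σ) (⊆[]-wk G))
  substitute (∀E {φ = φ} d t) σ G =
    transport (same φ (ε ▷ liftS S σ ▷ (t ⟨ σ ⟩ᵗ ∷ₛ var)) (ε ▷ (t ∷ₛ var) ▷ σ) agree)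
              (∀E (substitute d σ G) (t ⟨ σ ⟩ᵗ))
    where
      agree : liftS S σ ⨾ (t ⟨ σ ⟩ᵗ ∷ₛ var) ≈ (t ∷ₛ var) ⨾ σ
      agree x = trans (liftS-inst σ _ x) (sym (inst-⨾ t σ x))
  substitute (∃I {φ = φ} t d) σ G =
    ∃I (t ⟨ σ ⟩ᵗ) (transport (same φ (ε ▷ (t ∷ₛ var) ▷ σ) (ε ▷ liftS S σ ▷ (t ⟨ σ ⟩ᵗ ∷ₛ var)) agree)
                             (substitute d σ G))
    where
      agree : (t ∷ₛ var) ⨾ σ ≈ liftS S σ ⨾ (t ⟨ σ ⟩ᵗ ∷ₛ var)
      agree x = trans (inst-⨾ t σ x) (sym (liftS-inst σ _ x))
  substitute (∃E {φ = φ} {χ = χ} d d') σ G =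
    ∃E (substitute d σ G)
       (transport (same χ (ε ▷ wk ▷ liftS S σ) (ε ▷ σ ▷ wk) (λ _ → refl))
                  (substitute d' (liftS S σ) (⊆[]-,, φ (⊆[]-wk G))))

  weaken : {Δ : Ctx S n} {θ : Fm S n} → Δ ⊢ θ → wkCtx S Δ ⊢ θ ⟨ wk ⟩
  weaken d = substitute d wk (λ θ g → θ ⟨ wk ⟩ , (θ , g , refl) , ≃-refl)

  ⊢ᶜ-,, : {Γ Δ : Ctx S n} {φ : Fm S n} → Δ ⊢ᶜ Γ → Δ ,, φ ⊢ᶜ Γ ,, φ
  ⊢ᶜ-,, h ψ (inj₁ g) = mono (λ _ → inj₁) (h ψ g)
  ⊢ᶜ-,, h ψ (inj₂ e) = hyp (inj₂ e)

  ⊢ᶜ-wk : {Γ Δ : Ctx S n} → Δ ⊢ᶜ Γ → wkCtx S Δ ⊢ᶜ wkCtx S Γ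
  ⊢ᶜ-wk h _ (ψ , g , refl) = weaken (h ψ g)

  cut : {Γ Δ : Ctx S n} {φ : Fm S n} → Δ ⊢ᶜ Γ → Γ ⊢ φ → Δ ⊢ φ
  cut h (hyp g) = h _ g
  cut h ⊤I = ⊤I
  cut h (⊥E d) = ⊥E (cut h d)
  cut h (∧I d d') = ∧I (cut h d) (cut h d')
  cut h (∧E₁ d) = ∧E₁ (cut h d)
  cut h (∧E₂ d) = ∧E₂ (cut h d)
  cut h (⇒I d) = ⇒I (cut (⊢ᶜ-,, h) d)
  cut h (⇒E d d') = ⇒E (cut h d) (cut h d')
  cut h (⋀I ds) = ⋀I (λ i → cut h (ds i))
  cut h (⋀E d i) = ⋀E (cut h d) i
  cut h (⋁I i d) = ⋁I i (cut h d)
  cut h (⋁E d ds) = ⋁E (cut h d) (λ i → cut (⊢ᶜ-,, h) (ds i))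
  cut h (∀I d) = ∀I (cut (⊢ᶜ-wk h) d)
  cut h (∀E d t) = ∀E (cut h d) t
  cut h (∃I t d) = ∃I t (cut h d)
  cut h (∃E d d') = ∃E (cut h d) (cut (⊢ᶜ-,, (⊢ᶜ-wk h)) d')

  conj-intro : {Γ : Ctx S m} (L : List (Atom S n)) (τ : Subst n m) →
               (∀ a → a ∈ L → Γ ⊢ atom (a ⟨ τ ⟩ᵃ)) → Γ ⊢ conj S L ⟨ τ ⟩
  conj-intro [] τ h = ⊤I
  conj-intro (a ∷ L) τ h = ∧I (h a (here refl)) (conj-intro L τ (λ b b∈ → h b (there b∈)))

  conj-elim : {Γ : Ctx S m} {L : List (Atom S n)} {τ : Subst n m} {a : Atom S n} →
              a ∈ L → Γ ⊢ conj S L ⟨ τ ⟩ → Γ ⊢ atom (a ⟨ τ ⟩ᵃ)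
  conj-elim (here refl) d = ∧E₁ d
  conj-elim (there a∈) d = conj-elim a∈ (∧E₂ d)

  ∀*-elim : {Γ : Ctx S m} (n : ℕ) (β : Fm S n) →
            Γ ⊢ ∀* S n β ⟨ noVars S ⟩ → (τ : Subst n m) → Γ ⊢ β ⟨ τ ⟩
  ∀*-elim zero β d τ = transport (≃-cong β (λ ())) d
  ∀*-elim (suc n) β d τ =
    transport (same β (ε ▷ liftS S τ⁺ ▷ (τ zero ∷ₛ var)) (ε ▷ τ) agree)
              (∀E (∀*-elim n (∀' β) d τ⁺) (τ zero))
    where
      τ⁺ = λ x → τ (suc x)
      agree : liftS S τ⁺ ⨾ (τ zero ∷ₛ var) ≈ τ
      agree x = trans (liftS-inst τ⁺ (τ zero) x) (∷ₛ-η τ x)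

  wkCtxBy : (e : ℕ) → Ctx S n → Ctx S (e + n)
  wkCtxBy e Γ χ = Σ (Fm S _) λ ψ → Γ ψ × χ ≡ ψ ⟨ wkBy S e ⟩

  instSubst-suc : (e : ℕ) (σ : Subst n m) → liftS S (instSubst S e σ) ≈ instSubst S (suc e) σ
  instSubst-suc e σ zero = refl
  instSubst-suc {n} {m} e σ (suc x) = shift (splitAt e x)
    where
      shift : (s : Fin e ⊎ Fin n) →
              [ (λ j → var (j ↑ˡ m)) , (λ y → σ y ⟨ wkBy S e ⟩ᵗ) ]′ s ⟨ wk ⟩ᵗ ≡
              [ (λ j → var (j ↑ˡ m)) , (λ y → σ y ⟨ wkBy S (suc e) ⟩ᵗ) ]′ (map₁ suc s)
      shift (inj₁ j) = refl
      shift (inj₂ y) = ⟨⟩ᵗ-fuse (σ y) (λ _ → refl)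

  ∃*-elim : {Γ : Ctx S m} {χ : Fm S m} (e : ℕ) (Q : Fm S (e + n)) (σ : Subst n m) →
            Γ ⊢ ∃* S e Q ⟨ σ ⟩ → wkCtxBy e Γ ,, Q ⟨ instSubst S e σ ⟩ ⊢ χ ⟨ wkBy S e ⟩ → Γ ⊢ χ
  ∃*-elim {Γ = Γ} zero Q σ d P = transport ≃-id (cut hyps P)
    where
      hyps : Γ ⊢ᶜ wkCtxBy zero Γ ,, Q ⟨ instSubst S zero σ ⟩
      hyps _ (inj₁ (ψ , g , refl)) = transport (≃-sym ≃-id) (hyp g)
      hyps _ (inj₂ refl) = transport (≃-cong Q (λ x → sym (⟨⟩ᵗ-id (σ x)))) d
  ∃*-elim {Γ = Γ} {χ} (suc e) Q σ d P =
    ∃*-elim e (∃' Q) σ d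
      (∃E (hyp (inj₂ refl)) (transport (same χ (ε ▷ wkBy S (suc e)) (ε ▷ wkBy S e ▷ wk) (λ _ → refl))
                                       (cut hyps P)))
    where
      hyps : wkCtx S (wkCtxBy e Γ ,, ∃' Q ⟨ instSubst S e σ ⟩) ,, Q ⟨ liftS S (instSubst S e σ) ⟩
             ⊢ᶜ wkCtxBy (suc e) Γ ,, Q ⟨ instSubst S (suc e) σ ⟩
      hyps _ (inj₁ (ψ , g , refl)) =
        transport (same ψ (ε ▷ wkBy S e ▷ wk) (ε ▷ wkBy S (suc e)) (λ _ → refl))
                  (hyp (inj₁ (ψ ⟨ wkBy S e ⟩ , inj₁ (ψ , g , refl) , refl)))
      hyps _ (inj₂ refl) = transport (≃-cong Q (instSubst-suc e σ)) (hyp (inj₂ refl))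

  prim-subst : {α : Fm S n} (σ : Subst n m) → Prim S α → Prim S (α ⟨ σ ⟩)
  prim-subst σ (p-atom a) = p-atom (a ⟨ σ ⟩ᵃ)
  prim-subst σ p-⊤ = p-⊤
  prim-subst σ p-⊥ = p-⊥

  ggi-subst : {φ : Fm S n} (σ : Subst n m) → GGI S φ → GGI S (φ ⟨ σ ⟩)
  ggi-subst σ (g-prim α) = g-prim (prim-subst σ α)
  ggi-subst σ (g-∧ γ γ') = g-∧ (ggi-subst σ γ) (ggi-subst σ γ')
  ggi-subst σ (g-⋁ γs) = g-⋁ (λ i → ggi-subst σ (γs i))
  ggi-subst σ (g-∃ γ) = g-∃ (ggi-subst (liftS S σ) γ)
  ggi-subst σ (g-∀ γ) = g-∀ (ggi-subst (liftS S σ) γ)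
  ggi-subst σ (g-⇒ α γ) = g-⇒ (prim-subst σ α) (ggi-subst σ γ)

  renaming-kind : (κ : Kind) (r : Fin n → Fin m) → (∀ x y → r x ≡ r y → x ≡ y) →
                  IsKind S κ (λ x → var (r x))
  renaming-kind Cts r r-inj = tt
  renaming-kind Cvs r r-inj x = r x , refl
  renaming-kind Crn r r-inj = (λ x → r x , refl) , λ x y e → r-inj x y (var-injective e)
    where
      var-injective : {x y : Fin m} → var {S} x ≡ var y → x ≡ y
      var-injective refl = refl

  module _ (κ : Kind) (T : Theory S) where

    Hyps : List (Atom S n) → Ctx S n
    Hyps A = TA S T A

    _⊩_⟦_⟧ : (C : Cond S) → Fm S m → Subst m (ctx C) → Set₁
    C ⊩ φ ⟦ ρ ⟧ = ForcesEnv S κ T C φ ρ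

    inclusion : {A B : List (Atom S n)} → (∀ {a} → a ∈ A → a ∈ B) → Hom S κ (cond n B) (cond n A)
    inclusion {B = B} A⊆B =
      hom var (renaming-kind κ (λ x → x) (λ _ _ e → e)) (λ a a∈ → subst (_∈ B) (sym (⟨⟩ᵃ-id a)) (A⊆B a∈))

    idHom : (C : Cond S) → Hom S κ C C
    idHom C = inclusion (λ a∈ → a∈)

    wkCond : Cond S → Cond S
    wkCond C = cond (suc (ctx C)) (map (_⟨ wkBy S 1 ⟩ᵃ) (atoms C))

    wkHom : (C : Cond S) → Hom S κ (wkCond C) C
    wkHom C = hom (wkBy S 1) (renaming-kind κ suc (λ { _ _ refl → refl })) (λ a a∈ → ∈-map⁺ _ a∈)

    hom-hyps : {C D : Cond S} (f : Hom S κ D C) → Hyps (atoms C) ⊆[ Hom.fn f ] Hyps (atoms D)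
    hom-hyps f _ (inj₁ (ax , ax∈T , refl)) =
      _ , inj₁ (ax , ax∈T , refl) , ≃-sym (≃-closed (axiomFm S ax) (Hom.fn f))
    hom-hyps f _ (inj₂ (a , a∈ , refl)) = _ , inj₂ (_ , incl f a a∈ , refl) , ≃-refl

    weakened-hyps : {A : List (Atom S n)} {Γ : Ctx S n} (e : ℕ) →
                    Hyps A ⊆ Γ → wkCtxBy e Γ ⊢ᶜ Hyps (map (_⟨ wkBy S e ⟩ᵃ) A)
    weakened-hyps e A⊆Γ _ (inj₁ (ax , ax∈T , refl)) =
      transport (≃-closed (axiomFm S ax) (wkBy S e)) (hyp (_ , A⊆Γ _ (inj₁ (ax , ax∈T , refl)) , refl))
    weakened-hyps e A⊆Γ _ (inj₂ (b , b∈ , refl)) with ∈-map⁻ (_⟨ wkBy S e ⟩ᵃ) b∈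
    ... | a , a∈ , refl = hyp (atom a , A⊆Γ _ (inj₂ (a , a∈ , refl)) , refl)

    hyps-∷ : {A : List (Atom S n)} (b : Atom S n) → Hyps A ,, atom b ⊢ᶜ Hyps (b ∷ A)
    hyps-∷ b _ (inj₁ axiom) = hyp (inj₁ (inj₁ axiom))
    hyps-∷ b _ (inj₂ (_ , here refl , refl)) = hyp (inj₂ refl)
    hyps-∷ b _ (inj₂ (a , there a∈ , refl)) = hyp (inj₁ (inj₂ (a , a∈ , refl)))

    axiom-disjunction : {A : List (Atom S n)} (ax : CohAxiom S) → T ax → (σ : Subst (nv ax) n) →
                        (∀ a → a ∈ prem ax → a ⟨ σ ⟩ᵃ ∈ A) →
                        Hyps A ⊢ ⋁ (λ i → ∃* S (ex ax i) (conj S (concl ax i)) ⟨ σ ⟩)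
    axiom-disjunction ax ax∈T σ premise =
      ⇒E (∀*-elim (nv ax) _ (hyp (inj₁ (ax , ax∈T , refl))) σ)
         (conj-intro (prem ax) σ (λ a a∈ → hyp (inj₂ (_ , premise a a∈ , refl))))

    extension-elim : {C : Cond S} {χ : Fm S (ctx C)} (ax : CohAxiom S) (σ : Subst (nv ax) (ctx C))
                     (i : Fin (k ax)) → Hyps (atoms (extCond S C ax σ i)) ⊢ χ ⟨ wkBy S (ex ax i) ⟩ →
                     Hyps (atoms C) ,, ∃* S (ex ax i) (conj S (concl ax i)) ⟨ σ ⟩ ⊢ χ
    extension-elim {C} ax σ i d =
      ∃*-elim (ex ax i) (conj S (concl ax i)) σ (hyp (inj₂ refl)) (cut hyps d)
      where
        e = ex ax i
        Γ = Hyps (atoms C) ,, ∃* S e (conj S (concl ax i)) ⟨ σ ⟩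
        weakened : wkCtxBy e Γ ,, conj S (concl ax i) ⟨ instSubst S e σ ⟩ ⊢ᶜ
                   Hyps (map (_⟨ wkBy S e ⟩ᵃ) (atoms C))
        weakened ψ h = mono (λ _ → inj₁) (weakened-hyps e (λ _ → inj₁) ψ h)
        hyps : wkCtxBy e Γ ,, conj S (concl ax i) ⟨ instSubst S e σ ⟩ ⊢ᶜ Hyps (atoms (extCond S C ax σ i))
        hyps ψ (inj₁ axiom) = weakened ψ (inj₁ axiom)
        hyps ψ (inj₂ (b , b∈ , refl)) with ∈-++⁻ (map (_⟨ wkBy S e ⟩ᵃ) (atoms C)) b∈
        ... | inj₁ b∈A = weakened ψ (inj₂ (b , b∈A , refl))
        ... | inj₂ b∈φ with ∈-map⁻ (_⟨ instSubst S e σ ⟩ᵃ) b∈φ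
        ...   | a , a∈ , refl = conj-elim a∈ (hyp (inj₂ refl))

    derive-from-cover : {C : Cond S} {U : Family S κ C} → Covers S κ T C U →
                        (ψ : Fm S m) (ρ : Subst m (ctx C)) →
                        (∀ j → Hyps (atoms (dom U j)) ⊢ ψ ⟨ ρ ⨾ Hom.fn (mor U j) ⟩) →
                        Hyps (atoms C) ⊢ ψ ⟨ ρ ⟩
    derive-from-cover (cov-iso f (g , f⨾g≈id , _)) ψ ρ H =
      transport (same ψ (ε ▷ ρ ⨾ Hom.fn f ▷ Hom.fn g) (ε ▷ ρ) (λ x → ⟨⟩ᵗ-inverse (ρ x) f⨾g≈id))
                (substitute (H tt) (Hom.fn g) (hom-hyps g))
    derive-from-cover (cov-ax ax ax∈T σ premise U covers) ψ ρ H =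
      ⋁E (axiom-disjunction ax ax∈T σ premise) λ i →
        extension-elim ax σ i
          (transport (≃-sym (≃-fuse ψ (λ _ → refl)))
            (derive-from-cover (covers i) ψ (ρ ⨾ wkBy S (ex ax i)) λ j →
              transport (≃-cong ψ (λ x → sym (⟨⟩ᵗ-fuse (ρ x) (λ _ → refl)))) (H (i , j))))

    forced-derivable : {φ : Fm S m} → GGI S φ → (C : Cond S) (ρ : Subst m (ctx C)) →
                       C ⊩ φ ⟦ ρ ⟧ → Hyps (atoms C) ⊢ φ ⟨ ρ ⟩
    forced-derivable (g-prim (p-atom a)) C ρ (U , cover , forced) =
      derive-from-cover cover (atom a) ρ λ j →
        hyp (inj₂ (_ , subst (_∈ atoms (dom U j)) (⟨⟩ᵃ-fuse a (λ _ → refl)) (forced j) , refl))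
    forced-derivable (g-prim p-⊤) C ρ _ = ⊤I
    forced-derivable (g-prim p-⊥) C ρ (U , cover , empty) =
      derive-from-cover cover ⊥' ρ (λ j → ⊥-elim (empty j))
    forced-derivable (g-∧ γ γ') C ρ (F , F') = ∧I (forced-derivable γ C ρ F) (forced-derivable γ' C ρ F')
    forced-derivable (g-⋁ γs) C ρ (U , cover , F) =
      derive-from-cover cover (⋁ _) ρ λ j → let (i , Fj) = F j in
        ⋁I i (forced-derivable (γs i) (dom U j) _ Fj)
    forced-derivable (g-∃ {φ = φ} γ) C ρ (U , cover , F) =
      derive-from-cover cover (∃' φ) ρ λ j → let (t , Fj) = F j in
        ∃I t (transport (≃-sym (≃-fuse φ (liftS-inst _ t))) (forced-derivable γ (dom U j) _ Fj))
    forced-derivable (g-∀ γ) C ρ F =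
      ∀I (cut (weakened-hyps 1 (λ _ h → h))
              (forced-derivable γ (wkCond C) (var zero ∷ₛ ρ ⨾ wk) (F (wkCond C) (wkHom C) (var zero))))
    forced-derivable (g-⇒ p-⊥ γ) C ρ F = ⇒I (⊥E (hyp (inj₂ refl)))
    forced-derivable (g-⇒ {φ = φ} p-⊤ γ) C ρ F =
      ⇒I (mono (λ _ → inj₁) (transport (≃-cong φ (λ x → ⟨⟩ᵗ-id (ρ x)))
                                        (forced-derivable γ C (ρ ⨾ var) (F C (idHom C) (lift tt)))))
    forced-derivable (g-⇒ {φ = φ} (p-atom a) γ) C ρ F =
      ⇒I (transport (≃-cong φ (λ x → ⟨⟩ᵗ-id (ρ x)))
                    (cut (hyps-∷ (a ⟨ ρ ⟩ᵃ))
                         (forced-derivable γ C⁺ (ρ ⨾ var) (F C⁺ (inclusion there) forced-a))))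
      where
        C⁺ = cond (ctx C) (a ⟨ ρ ⟩ᵃ ∷ atoms C)
        forced-a : C⁺ ⊩ atom a ⟦ ρ ⨾ var ⟧
        forced-a = singleton S κ (idHom C⁺) ,
                   cov-iso (idHom C⁺) (idHom C⁺ , (λ _ → refl) , (λ _ → refl)) ,
                   λ _ → here (trans (⟨⟩ᵃ-id _) (⟨⟩ᵃ-cong a (λ x → ⟨⟩ᵗ-id (ρ x))))

-- Theorem 5.8.  Since φρ is again a generalized geometric implication, the
-- theorem is the case ρ = var of forced-derivable, up to φρ⟨var⟩ ≃ φρ.
theorem5p8 : (S : Signature) (κ : Kind) (T : Theory S) {m : ℕ} (φ : Fm S m) →
    GGI S φ → (C : Cond S) (ρ : Fin m → Tm S (ctx C)) →
    Forces S κ T C (substFm S φ ρ) →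
    Derivable S T (atoms C) (substFm S φ ρ)
theorem5p8 S κ T φ γ C ρ F =
  transport S (≃-id S) (forced-derivable S κ T (ggi-subst S ρ γ) C var F)
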